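{- Let $N$ be a net, let $P''$ be a finite GR-process of $N$, $\sigma''\in\mathrm{Lin}(P'')$, and $\sigma'\in\mathrm{FS}(N)$ with $\sigma''\le\sigma'$. Then there is a finite GR-process $P'$ of $N$ with $\sigma'\in\mathrm{Lin}(P')$ and $P''\le P'$.
   Context: A net is $N=(S,T,F,M_0)$ with $S,T$ disjoint, $F:(S\times T)\cup(T\times S)\to\mathbb{N}$, $M_0:S\to\mathbb{N}$, each transition having finitely many and at least one preplace and finitely many postplaces. ${}^\bullet x(y)=F(y,x)$, $x^\bullet(y)=F(x,y)$ (multisets), extended additively to finite multisets. For markings $M,M'$ and finite non-empty multiset $G$ of transitions, $M\xrightarrow{G}M'$ iff ${}^\bullet G\le M$ and $M'=(M-{}^\bullet G)+G^\bullet$. For a finite or infinite word $\sigma=t_1t_2\cdots$, $M\xrightarrow{\sigma}$ means $M\xrightarrow{\{t_1\}}M_1\xrightarrow{\{t_2\}}\cdots$. $\mathrm{FS}^\infty(N)$: words with $M_0\xrightarrow{\sigma}$; $\mathrm{FS}(N)$: finite ones. $\le$ on words is the prefix order. A GR-process of $N$ is $P=(\mathcal N,\pi)$ where $\mathcal N=(\mathcal S,\mathcal T,\mathcal F,\mathcal M_0)$ is a net such that each place $s$ has $|{}^\bullet s|\le1\ge|s^\bullet|$ and $\mathcal M_0(s)=1$ if ${}^\bullet s=\emptyset$, else $0$; $\mathcal F^+$ (transitive closure of $\{(x,y)\mid\mathcal F(x,y)>0\}$) is irreflexive; each $u\in\mathcal T$ has finitely many $t$ with $(t,u)\in\mathcal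 F^+$; and $\pi$ maps places to places, transitions to transitions, with $M_0(s)=|\pi^{ -1}(s)\cap\mathcal M_0|$ and $F(s,\pi(t))=|\pi^{ -1}(s)\cap{}^\bullet t|$, $F(\pi(t),s)=|\pi^{ -1}(s)\cap t^\bullet|$ for all $t\in\mathcal T,s\in S$. Finite means $\mathcal T$ finite. $P'\le P$ (prefix) iff places and transitions of $P'$ are subsets of those of $P$, initial markings coincide, and flow and $\pi$ of $P'$ are the restrictions of those of $P$. $P$ with transitions $\mathcal T$ and $\sigma=t_0t_1\cdots\in\mathrm{FS}^\infty(N)$ are compatible iff there is a bijection $\mathrm{pos}:\mathcal T\to I$ ($I=\{0,\dots,|\sigma|-1\}$ if $\sigma$ finite, $I=\mathbb N$ otherwise) with $\pi(t)=t_{\mathrm{pos}(t)}$ and $(t,t')\in\mathcal F^+\Rightarrow\mathrm{pos}(t)<\mathrm{pos}(t')$. $\mathrm{Lin}(P)$ is the set of firing sequences compatible with $P$. -}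

module Defs where

open import Data.Nat using (ℕ; zero; suc; _+_; _∸_; _≤_; _<_)
open import Data.Fin using (Fin; toℕ)
open import Data.List using (List; []; _∷_; _++_; length; lookup; map)
open import Data.Nat.ListAction using (sum)
open import Data.List.Membership.Propositional using (_∈_)
open import Data.List.Relation.Unary.All using (All)
open import Data.List.Relation.Unary.Unique.Propositional using (Unique)
open import Data.Product using (Σ; ∃; _×_; _,_)
open import Data.Sum using (_⊎_; inj₁; inj₂)
open import Data.Empty using (⊥)
open import Data.Unit using (⊤)
open import Relation.Nullary using (¬_)
open import Relation.Binary.PropositionalEquality using (_≡_)
open import Relation.Binary.Construct.Closure.Transitive using (TransClosure)
open import Function.Definitions using (Injective; Bijective)

-- SumOver P f n : "f has finite support on {a | P a} and Σ_{a ∈ P} f a = n".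

SumOver : {A : Set} → (A → Set) → (A → ℕ) → ℕ → Set
SumOver {A} P f n =
  Σ (List A) λ xs →
    Unique xs × All P xs × (∀ a → P a → 0 < f a → a ∈ xs) × sum (map f xs) ≡ n

SumIs : {A : Set} → (A → ℕ) → ℕ → Set
SumIs f n = SumOver (λ _ → ⊤) f n

AtMostOne : {A : Set} → (A → ℕ) → Set
AtMostOne f = Σ ℕ λ n → SumIs f n × n ≤ 1

FinitelyMany : {A : Set} → (A → Set) → Set
FinitelyMany {A} P = Σ (List A) λ xs → ∀ a → P a → a ∈ xs

record Net : Set₁ where
  field
    S    : Set
    T    : Set
    Fst  : S → T → ℕ
    Fts  : T → S → ℕ
    M₀   : S → ℕ
    pre-finite    : ∀ t → FinitelyMany (λ s → 0 < Fst s t)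
    post-finite   : ∀ t → FinitelyMany (λ s → 0 < Fts t s)
    pre-nonempty  : ∀ t → ∃ λ s → 0 < Fst s t

open Net public

Marking : Net → Set
Marking N = S N → ℕ

Step : (N : Net) → Marking N → T N → Marking N → Set
Step N M t M' = (∀ s → Fst N s t ≤ M s) × (∀ s → M' s ≡ (M s ∸ Fst N s t) + Fts N t s)

data Fires (N : Net) : Marking N → List (T N) → Set where
  fire-[] : ∀ {M} → Fires N M []
  fire-∷  : ∀ {M M' t σ} → Step N M t M' → Fires N M' σ → Fires N M (t ∷ σ)

FS : (N : Net) → List (T N) → Set
FS N σ = Fires N (M₀ N) σ

_≼_ : {A : Set} → List A → List A → Set
σ ≼ σ' = ∃ λ τ → σ ++ τ ≡ σ'

Arc : (N : Net) → S N ⊎ T N → S N ⊎ T N → Set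
Arc N (inj₁ s) (inj₂ t) = 0 < Fst N s t
Arc N (inj₂ t) (inj₁ s) = 0 < Fts N t s
Arc N (inj₁ _) (inj₁ _) = ⊥
Arc N (inj₂ _) (inj₂ _) = ⊥

Flow⁺ : (N : Net) → S N ⊎ T N → S N ⊎ T N → Set
Flow⁺ N = TransClosure (Arc N)

record GRProcess (N : Net) : Set₁ where
  field
    𝒩 : Net
    pre-≤1   : ∀ s → AtMostOne (λ t → Fts 𝒩 t s)
    post-≤1  : ∀ s → AtMostOne (λ t → Fst 𝒩 s t)
    init-1   : ∀ s → (∀ t → Fts 𝒩 t s ≡ 0) → M₀ 𝒩 s ≡ 1
    init-0   : ∀ s → ¬ (∀ t → Fts 𝒩 t s ≡ 0) → M₀ 𝒩 s ≡ 0
    irrefl   : ∀ x → ¬ Flow⁺ 𝒩 x x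
    fin-past : ∀ u → FinitelyMany (λ t → Flow⁺ 𝒩 (inj₂ t) (inj₂ u))
    πS : S 𝒩 → S N
    πT : T 𝒩 → T N
    π-M₀  : ∀ s → SumOver (λ p → πS p ≡ s) (M₀ 𝒩) (M₀ N s)
    π-pre  : ∀ t s → SumOver (λ p → πS p ≡ s) (λ p → Fst 𝒩 p t) (Fst N s (πT t))
    π-post : ∀ t s → SumOver (λ p → πS p ≡ s) (λ p → Fts 𝒩 t p) (Fts N (πT t) s)

open GRProcess public

𝒯 : {N : Net} → GRProcess N → Set
𝒯 P = T (𝒩 P)

𝒮 : {N : Net} → GRProcess N → Set
𝒮 P = S (𝒩 P)

FiniteProcess : {N : Net} → GRProcess N → Set
FiniteProcess P = Σ (List (𝒯 P)) λ xs → ∀ t → t ∈ xs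

-- Prefix P' ≤ P.  "Subset" is rendered by injective embeddings of the
-- places and transitions of P' into those of P.
record _≤ₚ_ {N : Net} (P' P : GRProcess N) : Set where
  field
    ιS : 𝒮 P' → 𝒮 P
    ιT : 𝒯 P' → 𝒯 P
    ιS-inj : Injective _≡_ _≡_ ιS
    ιT-inj : Injective _≡_ _≡_ ιT
    M₀-restr : ∀ p → M₀ (𝒩 P') p ≡ M₀ (𝒩 P) (ιS p)
    M₀-cover : ∀ p → 0 < M₀ (𝒩 P) p → ∃ λ p' → ιS p' ≡ p
    Fst-restr : ∀ p t → Fst (𝒩 P') p t ≡ Fst (𝒩 P) (ιS p) (ιT t)
    Fts-restr : ∀ t p → Fts (𝒩 P') t p ≡ Fts (𝒩 P) (ιT t) (ιS p)
    πS-restr : ∀ p → πS P' p ≡ πS P (ιS p)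
    πT-restr : ∀ t → πT P' t ≡ πT P (ιT t)

Compatible : {N : Net} → GRProcess N → List (T N) → Set
Compatible P σ =
  Σ (𝒯 P → Fin (length σ)) λ pos →
    Bijective _≡_ _≡_ pos ×
    (∀ t → πT P t ≡ lookup σ (pos t)) ×
    (∀ t t' → Flow⁺ (𝒩 P) (inj₂ t) (inj₂ t') → toℕ (pos t) < toℕ (pos t'))

Lin : {N : Net} → GRProcess N → List (T N) → Set
Lin {N} P σ = FS N σ × Compatible P σ

-- By induction along σ' = σ'' τ it suffices to append a single event. Let P be compatible with σ,
-- where σ leads to the marking M. Every place of P is either initial or produced by exactly one
-- event and is consumed by at most one, so summing the marking equation over the places lying
-- over s shows that exactly M(s) of them are not consumed by any event of P. If t is enabled at M,
-- pick F(s,t) such unconsumed places over each s as the preset of a new event labelled t and give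
-- it F(t,s) fresh postplaces over each s; the result is again a GR-process, it extends P, and it
-- is compatible with σ t, the new event being placed last.

module Submission where

open import Defs
open import Data.Empty using (⊥-elim)
open import Data.Fin using (Fin; toℕ; fromℕ<)
open import Data.Fin.Properties using (toℕ<n; toℕ-fromℕ<; toℕ-injective)
open import Data.List using (List; []; _∷_; _++_; length; map; filter; take; lookup; concatMap; allFin)
open import Data.List.Properties
  using (map-++; map-∘; filter-accept; filter-reject; length-++; length-take; length-tabulate;
         map-tabulate; tabulate-lookup; ++-assoc; ++-identityʳ)
open import Data.List.Membership.Propositional using (_∈_; find; lose)
open import Data.List.Membership.Propositional.Properties
  using (∈-map⁺; ∈-map⁻; ∈-allFin; ∈-++⁺ˡ; ∈-++⁺ʳ; ∈-++⁻; ∈-filter⁺; ∈-filter⁻; ∈-concatMap⁺; ∈-concatMap⁻; ∈-length)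
open import Data.List.Membership.Propositional.Properties.WithK using (unique∧set⇒bag; unique⇒irrelevant)
open import Data.List.Relation.Binary.BagAndSetEquality using (∼bag⇒↭)
open import Data.List.Relation.Binary.Permutation.Propositional using (_↭_)
import Data.List.Relation.Binary.Permutation.Propositional.Properties as ↭
open import Data.List.Relation.Unary.All as All using (All)
open import Data.List.Relation.Unary.All.Properties as All using ()
open import Data.List.Relation.Unary.Any using (here; there; index)
open import Data.List.Relation.Unary.Unique.Propositional using (Unique; []; _∷_)
open import Data.List.Relation.Unary.Unique.Propositional.Properties using (map⁺; allFin⁺; filter⁺; take⁺; ++⁺)
open import Data.Nat using (ℕ; zero; suc; _+_; _∸_; _≤_; _<_; z≤n; s≤s; _<?_; _≟_)
open import Data.Nat.ListAction using (sum)
open import Data.Nat.ListAction.Properties using (sum-++; sum-↭)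
open import Data.Nat.Properties
open import Algebra.Properties.CommutativeSemigroup +-commutativeSemigroup using (interchange; x∙yz≈y∙xz)
open import Data.Product using (Σ; ∃; _×_; _,_; proj₁; proj₂)
open import Data.Sum using (_⊎_; inj₁; inj₂)
open import Data.Sum.Properties using (inj₁-injective)
open import Data.Unit using (⊤; tt)
open import Function using (_∘_)
open import Function.Bundles using (mk⇔)
open import Relation.Nullary using (¬_; Dec; yes; no)
open import Relation.Binary.PropositionalEquality
open import Relation.Binary.Construct.Closure.Transitive using ([_]; _∷_)

sumMap : {A : Set} → (A → ℕ) → List A → ℕ
sumMap f xs = sum (map f xs)

module _ {A : Set} where

  sumMap-++ : (f : A → ℕ) (xs ys : List A) → sumMap f (xs ++ ys) ≡ sumMap f xs + sumMap f ys
  sumMap-++ f xs ys = trans (cong sum (map-++ f xs ys)) (sum-++ (map f xs) (map f ys))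

  sumMap-cong : {f g : A → ℕ} (xs : List A) → (∀ {a} → a ∈ xs → f a ≡ g a) → sumMap f xs ≡ sumMap g xs
  sumMap-cong []       f≡g = refl
  sumMap-cong (x ∷ xs) f≡g = cong₂ _+_ (f≡g (here refl)) (sumMap-cong xs (f≡g ∘ there))

  sumMap-+ : (f g : A → ℕ) (xs : List A) → sumMap (λ a → f a + g a) xs ≡ sumMap f xs + sumMap g xs
  sumMap-+ f g []       = refl
  sumMap-+ f g (x ∷ xs) =
    trans (cong (f x + g x +_) (sumMap-+ f g xs)) (interchange (f x) (g x) (sumMap f xs) (sumMap g xs))

  sumMap-const-1 : (xs : List A) → sumMap (λ _ → 1) xs ≡ length xs
  sumMap-const-1 []       = refl
  sumMap-const-1 (x ∷ xs) = cong suc (sumMap-const-1 xs)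

  sumMap-zero : (f : A → ℕ) (xs : List A) → (∀ {a} → a ∈ xs → f a ≡ 0) → sumMap f xs ≡ 0
  sumMap-zero f xs f≡0 = trans (sumMap-cong xs f≡0) (sumMap-const-0 xs)
    where
    sumMap-const-0 : (xs : List A) → sumMap (λ _ → 0) xs ≡ 0
    sumMap-const-0 []       = refl
    sumMap-const-0 (x ∷ xs) = sumMap-const-0 xs

  sumMap≡0⇒≡0 : (f : A → ℕ) (xs : List A) → sumMap f xs ≡ 0 → ∀ {a} → a ∈ xs → f a ≡ 0
  sumMap≡0⇒≡0 f (x ∷ xs) sum≡0 (here refl) = m+n≡0⇒m≡0 (f x) sum≡0
  sumMap≡0⇒≡0 f (x ∷ xs) sum≡0 (there a∈) = sumMap≡0⇒≡0 f xs (m+n≡0⇒n≡0 (f x) sum≡0) a∈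

  ≤-sumMap : (f : A → ℕ) {xs : List A} {a : A} → a ∈ xs → f a ≤ sumMap f xs
  ≤-sumMap f {x ∷ xs} (here refl) = m≤m+n (f x) (sumMap f xs)
  ≤-sumMap f {x ∷ xs} (there a∈) = ≤-trans (≤-sumMap f a∈) (m≤n+m (sumMap f xs) (f x))

  sumMap>0⇒positive : (f : A → ℕ) (xs : List A) → 0 < sumMap f xs → ∃ λ a → a ∈ xs × 0 < f a
  sumMap>0⇒positive f (x ∷ xs) sum>0 with 0 <? f x
  ... | yes fx>0 = x , here refl , fx>0
  ... | no fx≯0 with sumMap>0⇒positive f xs (subst (0 <_) (cong (_+ sumMap f xs) (n≤0⇒n≡0 (≮⇒≥ fx≯0))) sum>0)
  ...   | a , a∈ , fa>0 = a , there a∈ , fa>0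

  sumMap≤1⇒positive-unique : (f : A → ℕ) (xs : List A) → sumMap f xs ≤ 1 →
                              ∀ {a b} → a ∈ xs → b ∈ xs → 0 < f a → 0 < f b → a ≡ b
  sumMap≤1⇒positive-unique f (x ∷ xs) ≤1 (here refl) (here refl) _ _ = refl
  sumMap≤1⇒positive-unique f (x ∷ xs) ≤1 (here refl) (there b∈) fx>0 fb>0 =
    ⊥-elim (<⇒≱ (≤-trans (+-mono-≤ fx>0 (≤-trans fb>0 (≤-sumMap f b∈))) ≤1) ≤-refl)
  sumMap≤1⇒positive-unique f (x ∷ xs) ≤1 (there a∈) (here refl) fa>0 fx>0 =
    ⊥-elim (<⇒≱ (≤-trans (+-mono-≤ fx>0 (≤-trans fa>0 (≤-sumMap f a∈))) ≤1) ≤-refl)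
  sumMap≤1⇒positive-unique f (x ∷ xs) ≤1 (there a∈) (there b∈) =
    sumMap≤1⇒positive-unique f xs (≤-trans (m≤n+m (sumMap f xs) (f x)) ≤1) a∈ b∈

  sumMap-filter-positive : (f : A → ℕ) (xs : List A) → sumMap f (filter (λ a → 0 <? f a) xs) ≡ sumMap f xs
  sumMap-filter-positive f []       = refl
  sumMap-filter-positive f (x ∷ xs) with 0 <? f x
  ... | yes fx>0 rewrite filter-accept (λ a → 0 <? f a) {xs = xs} fx>0 =
    cong (f x +_) (sumMap-filter-positive f xs)
  ... | no fx≯0 rewrite filter-reject (λ a → 0 <? f a) {xs = xs} fx≯0 | n≤0⇒n≡0 (≮⇒≥ fx≯0) =
    sumMap-filter-positive f xs

  -- The positive parts of two duplicate-free lists with the same support are permutations of each other.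
  sumMap-support : (f : A → ℕ) {xs ys : List A} → Unique xs → Unique ys →
                   (∀ {a} → 0 < f a → a ∈ xs → a ∈ ys) → (∀ {a} → 0 < f a → a ∈ ys → a ∈ xs) →
                   sumMap f xs ≡ sumMap f ys
  sumMap-support f {xs} {ys} xs! ys! xs⊆ys ys⊆xs = begin
    sumMap f xs                            ≡⟨ sumMap-filter-positive f xs ⟨
    sumMap f (filter (λ a → 0 <? f a) xs)  ≡⟨ sum-↭ (↭.map⁺ f positives-↭) ⟩
    sumMap f (filter (λ a → 0 <? f a) ys)  ≡⟨ sumMap-filter-positive f ys ⟩
    sumMap f ys                            ∎
    where
    open ≡-Reasoning
    positive-part : ∀ {zs ws} → (∀ {a} → 0 < f a → a ∈ zs → a ∈ ws) →
                    ∀ {a} → a ∈ filter (λ a → 0 <? f a) zs → a ∈ filter (λ a → 0 <? f a) ws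
    positive-part zs⊆ws a∈ with ∈-filter⁻ (λ a → 0 <? f a) a∈
    ... | a∈zs , fa>0 = ∈-filter⁺ (λ a → 0 <? f a) (zs⊆ws fa>0 a∈zs) fa>0
    positives-↭ : filter (λ a → 0 <? f a) xs ↭ filter (λ a → 0 <? f a) ys
    positives-↭ = ∼bag⇒↭ (unique∧set⇒bag (filter⁺ (λ a → 0 <? f a) xs!) (filter⁺ (λ a → 0 <? f a) ys!)
                                          (mk⇔ (positive-part xs⊆ys) (positive-part ys⊆xs)))

  length-filter-≟0 : (g : A → ℕ) (xs : List A) → length (filter (λ a → g a ≟ 0) xs) ≡ sumMap (λ a → 1 ∸ g a) xs
  length-filter-≟0 g []       = refl
  length-filter-≟0 g (x ∷ xs) with g x ≟ 0
  ... | yes gx≡0 rewrite filter-accept (λ a → g a ≟ 0) {xs = xs} gx≡0 | gx≡0 =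
    cong suc (length-filter-≟0 g xs)
  ... | no gx≢0 rewrite filter-reject (λ a → g a ≟ 0) {xs = xs} gx≢0
                       | m≤n⇒m∸n≡0 (n≢0⇒n>0 gx≢0) = length-filter-≟0 g xs

module _ {A B : Set} where

  sumMap-map : (f : B → ℕ) (h : A → B) (xs : List A) → sumMap f (map h xs) ≡ sumMap (f ∘ h) xs
  sumMap-map f h xs = cong sum (sym (map-∘ xs))

  sumMap-swap : (g : A → B → ℕ) (xs : List A) (ys : List B) →
                sumMap (λ a → sumMap (g a) ys) xs ≡ sumMap (λ b → sumMap (λ a → g a b) xs) ys
  sumMap-swap g []       ys = sym (sumMap-zero _ ys (λ _ → refl))
  sumMap-swap g (x ∷ xs) ys =
    trans (cong (sumMap (g x) ys +_) (sumMap-swap g xs ys)) (sym (sumMap-+ (g x) _ ys))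


module _ {A : Set} {P : A → Set} {f : A → ℕ} {n : ℕ} where

  SumOver⇒sumMap≡ : SumOver P f n → {xs : List A} → Unique xs →
                    (∀ {a} → a ∈ xs → P a) → (∀ {a} → P a → a ∈ xs) → sumMap f xs ≡ n
  SumOver⇒sumMap≡ (zs , zs! , zs⊆P , P⊆zs , sum≡n) xs! xs⊆P P⊆xs =
    trans (sumMap-support f xs! zs! (λ fa>0 a∈xs → P⊆zs _ (xs⊆P a∈xs) fa>0)
                                    (λ _ a∈zs → P⊆xs (All.lookup zs⊆P a∈zs)))
          sum≡n

  support : SumOver P f n → List A
  support (zs , _) = filter (λ a → 0 <? f a) zs

  support-unique : (w : SumOver P f n) → Unique (support w)
  support-unique (zs , zs! , _) = filter⁺ (λ a → 0 <? f a) zs!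

  support-sound : (w : SumOver P f n) → ∀ {a} → a ∈ support w → P a × 0 < f a
  support-sound (zs , _ , zs⊆P , _) a∈ with ∈-filter⁻ (λ a → 0 <? f a) a∈
  ... | a∈zs , fa>0 = All.lookup zs⊆P a∈zs , fa>0

  support-complete : (w : SumOver P f n) → ∀ {a} → P a → 0 < f a → a ∈ support w
  support-complete (zs , _ , _ , P⊆zs , _) Pa fa>0 = ∈-filter⁺ (λ a → 0 <? f a) (P⊆zs _ Pa fa>0) fa>0

SumOver-inj₁ : {A B : Set} {P : A ⊎ B → Set} {f : A ⊎ B → ℕ} {n : ℕ} → (∀ b → f (inj₂ b) ≡ 0) →
               SumOver (P ∘ inj₁) (f ∘ inj₁) n → SumOver P f n
SumOver-inj₁ {P = P} {f = f} f∘inj₂≡0 (zs , zs! , zs⊆P , P⊆zs , sum≡n) =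
  map inj₁ zs , map⁺ inj₁-injective zs! , All.map⁺ zs⊆P , P⊆inj₁zs , trans (sumMap-map f inj₁ zs) sum≡n
  where
  P⊆inj₁zs : ∀ c → P c → 0 < f c → c ∈ map inj₁ zs
  P⊆inj₁zs (inj₁ a) Pa fa>0 = ∈-map⁺ inj₁ (P⊆zs a Pa fa>0)
  P⊆inj₁zs (inj₂ b) _ fb>0 = ⊥-elim (<-irrefl (sym (f∘inj₂≡0 b)) fb>0)

module _ {A : Set} where

  ∈-take⁺ : ∀ k {xs : List A} {a} (a∈ : a ∈ xs) → toℕ (index a∈) < k → a ∈ take k xs
  ∈-take⁺ (suc k) (here a≡x) _          = here a≡x
  ∈-take⁺ (suc k) (there a∈) (s≤s i<k) = there (∈-take⁺ k a∈ i<k)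

  ∈-take⁻ : ∀ k {xs : List A} {a} → a ∈ take k xs → Σ (a ∈ xs) λ a∈ → toℕ (index a∈) < k
  ∈-take⁻ (suc k) {x ∷ xs} (here a≡x) = here a≡x , s≤s z≤n
  ∈-take⁻ (suc k) {x ∷ xs} (there a∈) with ∈-take⁻ k a∈
  ... | a∈xs , i<k = there a∈xs , s≤s i<k

  -- Membership in a prefix is decided by the position of the element, which is unique.
  ∈-take? : ∀ k {xs : List A} → Unique xs → ∀ {a} → a ∈ xs → Dec (a ∈ take k xs)
  ∈-take? k xs! a∈ with toℕ (index a∈) <? k
  ... | yes i<k = yes (∈-take⁺ k a∈ i<k)
  ... | no i≮k = no λ a∈take → let a∈′ , i′<k = ∈-take⁻ k a∈take in
                   i≮k (subst (λ a∈″ → toℕ (index a∈″) < k) (unique⇒irrelevant xs! a∈′ a∈) i′<k)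

module _ {A B : Set} (g : A → List B) where

  ∈-concatMap⁺′ : ∀ {a b as} → b ∈ g a → a ∈ as → b ∈ concatMap g as
  ∈-concatMap⁺′ b∈ a∈ = ∈-concatMap⁺ g (lose a∈ b∈)

  ∈-concatMap⁻′ : ∀ {b} as → b ∈ concatMap g as → ∃ λ a → a ∈ as × b ∈ g a
  ∈-concatMap⁻′ as b∈ = find (∈-concatMap⁻ g b∈)

  concatMap-unique : ∀ {as} → Unique as → (∀ a → Unique (g a)) → (∀ {a a′ b} → b ∈ g a → b ∈ g a′ → a ≡ a′) →
                     Unique (concatMap g as)
  concatMap-unique {[]}     []         g! disjoint = []
  concatMap-unique {a ∷ as} (a∉ ∷ as!) g! disjoint = ++⁺ (g! a) (concatMap-unique as! g! disjoint) separate
    where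
    separate : ∀ {b} → ¬ (b ∈ g a × b ∈ concatMap g as)
    separate (b∈ga , b∈rest) with ∈-concatMap⁻′ as b∈rest
    ... | a′ , a′∈as , b∈ga′ = All.lookup a∉ a′∈as (disjoint b∈ga b∈ga′)

module _ {A : Set} where

  length-∷ʳ : (xs : List A) (y : A) → length (xs ++ y ∷ []) ≡ suc (length xs)
  length-∷ʳ xs y = trans (length-++ xs) (+-comm (length xs) 1)

  lookup-++ˡ : (xs ys : List A) (i : Fin (length (xs ++ ys))) (j : Fin (length xs)) →
               toℕ i ≡ toℕ j → lookup (xs ++ ys) i ≡ lookup xs j
  lookup-++ˡ (x ∷ xs) ys Fin.zero    Fin.zero    _   = refl
  lookup-++ˡ (x ∷ xs) ys (Fin.suc i) (Fin.suc j) i≡j = lookup-++ˡ xs ys i j (suc-injective i≡j)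

  lookup-∷ʳ-last : (xs : List A) (y : A) (i : Fin (length (xs ++ y ∷ []))) → toℕ i ≡ length xs →
                   lookup (xs ++ y ∷ []) i ≡ y
  lookup-∷ʳ-last []       y Fin.zero    _   = refl
  lookup-∷ʳ-last (x ∷ xs) y (Fin.suc i) i≡n = lookup-∷ʳ-last xs y i (suc-injective i≡n)

nonempty-member : {A : Set} (xs : List A) → 0 < length xs → ∃ λ a → a ∈ xs
nonempty-member (x ∷ xs) _ = x , here refl

data FiresTo (N : Net) : Marking N → List (T N) → Marking N → Set where
  fires-[] : ∀ {M} → FiresTo N M [] M
  fires-∷  : ∀ {M M₁ M₂ t σ} → Step N M t M₁ → FiresTo N M₁ σ M₂ → FiresTo N M (t ∷ σ) M₂

module _ {N : Net} where

  fires-++⁻ : ∀ {M} σ {τ} → Fires N M (σ ++ τ) → ∃ λ M′ → FiresTo N M σ M′ × Fires N M′ τ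
  fires-++⁻ []      στ                = _ , fires-[] , στ
  fires-++⁻ (t ∷ σ) (fire-∷ step στ) with fires-++⁻ σ στ
  ... | M′ , σ-fires , τ-fires = M′ , fires-∷ step σ-fires , τ-fires

  fires-prefix : ∀ {M} σ {τ} → Fires N M (σ ++ τ) → Fires N M σ
  fires-prefix []      _                = fire-[]
  fires-prefix (t ∷ σ) (fire-∷ step στ) = fire-∷ step (fires-prefix σ στ)

  -- Stated with both sides moved so that no truncated subtraction occurs.
  marking-equation : ∀ {M σ M′} → FiresTo N M σ M′ → ∀ s →
                     M′ s + sumMap (Fst N s) σ ≡ M s + sumMap (λ t → Fts N t s) σ
  marking-equation fires-[] s = refl
  marking-equation {M} {t ∷ σ} {M′} (fires-∷ {M₁ = M₁} (enabled , M₁≡) σ-fires) s = begin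
    M′ s + (a + A)              ≡⟨ x∙yz≈y∙xz (M′ s) a A ⟩
    a + (M′ s + A)              ≡⟨ cong (a +_) (marking-equation σ-fires s) ⟩
    a + (M₁ s + B)              ≡⟨ cong (λ m → a + (m + B)) (M₁≡ s) ⟩
    a + ((M s ∸ a) + b + B)     ≡⟨ cong (a +_) (+-assoc (M s ∸ a) b B) ⟩
    a + ((M s ∸ a) + (b + B))   ≡⟨ +-assoc a (M s ∸ a) (b + B) ⟨
    (a + (M s ∸ a)) + (b + B)   ≡⟨ cong (_+ (b + B)) (m+[n∸m]≡n (enabled s)) ⟩
    M s + (b + B)               ∎
    where
    open ≡-Reasoning
    a b A B : ℕ
    a = Fst N s t
    b = Fts N t s
    A = sumMap (Fst N s) σ
    B = sumMap (λ t → Fts N t s) σ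

  ≤ₚ-refl : {P : GRProcess N} → P ≤ₚ P
  ≤ₚ-refl = record
    { ιS = λ p → p ; ιT = λ u → u ; ιS-inj = λ eq → eq ; ιT-inj = λ eq → eq
    ; M₀-restr = λ _ → refl ; M₀-cover = λ p _ → p , refl
    ; Fst-restr = λ _ _ → refl ; Fts-restr = λ _ _ → refl
    ; πS-restr = λ _ → refl ; πT-restr = λ _ → refl }

  ≤ₚ-trans : {P₁ P₂ P₃ : GRProcess N} → P₁ ≤ₚ P₂ → P₂ ≤ₚ P₃ → P₁ ≤ₚ P₃
  ≤ₚ-trans {P₁} {P₂} {P₃} P₁≤P₂ P₂≤P₃ = record
    { ιS = B.ιS ∘ A.ιS ; ιT = B.ιT ∘ A.ιT
    ; ιS-inj = A.ιS-inj ∘ B.ιS-inj ; ιT-inj = A.ιT-inj ∘ B.ιT-inj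
    ; M₀-restr = λ p → trans (A.M₀-restr p) (B.M₀-restr (A.ιS p))
    ; M₀-cover = cover
    ; Fst-restr = λ p u → trans (A.Fst-restr p u) (B.Fst-restr (A.ιS p) (A.ιT u))
    ; Fts-restr = λ u p → trans (A.Fts-restr u p) (B.Fts-restr (A.ιT u) (A.ιS p))
    ; πS-restr = λ p → trans (A.πS-restr p) (B.πS-restr (A.ιS p))
    ; πT-restr = λ u → trans (A.πT-restr u) (B.πT-restr (A.ιT u)) }
    where
    module A = _≤ₚ_ P₁≤P₂
    module B = _≤ₚ_ P₂≤P₃
    cover : ∀ p → 0 < M₀ (𝒩 P₃) p → ∃ λ p₁ → B.ιS (A.ιS p₁) ≡ p
    cover p M₀p>0 with B.M₀-cover p M₀p>0
    ... | p₂ , refl with A.M₀-cover p₂ (subst (0 <_) (sym (B.M₀-restr p₂)) M₀p>0)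
    ... | p₁ , refl = p₁ , refl

module CompatibleProcess {N : Net} (P : GRProcess N) (σ : List (T N)) (compatible : Compatible P σ) where

  Nₚ : Net
  Nₚ = 𝒩 P

  pos : T Nₚ → Fin (length σ)
  pos = proj₁ compatible

  pos-injective : ∀ {u u′} → pos u ≡ pos u′ → u ≡ u′
  pos-injective = proj₁ (proj₁ (proj₂ compatible))

  pos⁻¹ : Fin (length σ) → T Nₚ
  pos⁻¹ i = proj₁ (proj₂ (proj₁ (proj₂ compatible)) i)

  pos∘pos⁻¹ : ∀ i → pos (pos⁻¹ i) ≡ i
  pos∘pos⁻¹ i = proj₂ (proj₂ (proj₁ (proj₂ compatible)) i) refl

  πT≡lookup : ∀ u → πT P u ≡ lookup σ (pos u)
  πT≡lookup = proj₁ (proj₂ (proj₂ compatible))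

  pos-monotone : ∀ u u′ → Flow⁺ Nₚ (inj₂ u) (inj₂ u′) → toℕ (pos u) < toℕ (pos u′)
  pos-monotone = proj₂ (proj₂ (proj₂ compatible))

  events : List (T Nₚ)
  events = map pos⁻¹ (allFin (length σ))

  events-unique : Unique events
  events-unique = map⁺ (λ {i} {j} eq → trans (sym (pos∘pos⁻¹ i)) (trans (cong pos eq) (pos∘pos⁻¹ j))) (allFin⁺ _)

  ∈-events : ∀ u → u ∈ events
  ∈-events u = subst (_∈ events) (pos-injective (pos∘pos⁻¹ (pos u))) (∈-map⁺ pos⁻¹ (∈-allFin (pos u)))

  sumMap-events-πT : (h : T N → ℕ) → sumMap (h ∘ πT P) events ≡ sumMap h σ
  sumMap-events-πT h = begin
    sumMap (h ∘ πT P) events                      ≡⟨ sumMap-map (h ∘ πT P) pos⁻¹ (allFin _) ⟩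
    sumMap (h ∘ πT P ∘ pos⁻¹) (allFin (length σ)) ≡⟨ sumMap-cong (allFin _) (λ {i} _ → cong h (lookup-pos⁻¹ i)) ⟩
    sumMap (h ∘ lookup σ) (allFin (length σ))     ≡⟨ sumMap-map h (lookup σ) (allFin _) ⟨
    sumMap h (map (lookup σ) (allFin (length σ))) ≡⟨ cong (sumMap h) (trans (map-tabulate (λ i → i) (lookup σ))
                                                                            (tabulate-lookup σ)) ⟩
    sumMap h σ                                    ∎
    where
    open ≡-Reasoning
    lookup-pos⁻¹ : ∀ i → πT P (pos⁻¹ i) ≡ lookup σ i
    lookup-pos⁻¹ i = trans (πT≡lookup (pos⁻¹ i)) (cong (lookup σ) (pos∘pos⁻¹ i))

  sumMap-events≤1 : {f : T Nₚ → ℕ} → AtMostOne f → sumMap f events ≤ 1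
  sumMap-events≤1 (n , total , n≤1) =
    subst (_≤ 1) (sym (SumOver⇒sumMap≡ total events-unique (λ _ → tt) (λ _ → ∈-events _))) n≤1

  indeg : S Nₚ → ℕ
  indeg p = sumMap (λ u → Fts Nₚ u p) events

  outdeg : S Nₚ → ℕ
  outdeg p = sumMap (Fst Nₚ p) events

  indeg≤1 : ∀ p → indeg p ≤ 1
  indeg≤1 p = sumMap-events≤1 (pre-≤1 P p)

  outdeg≤1 : ∀ p → outdeg p ≤ 1
  outdeg≤1 p = sumMap-events≤1 (post-≤1 P p)

  producer-unique : ∀ {u u′ p} → 0 < Fts Nₚ u p → 0 < Fts Nₚ u′ p → u ≡ u′
  producer-unique {p = p} =
    sumMap≤1⇒positive-unique (λ u → Fts Nₚ u p) events (indeg≤1 p) (∈-events _) (∈-events _)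

  M₀+indeg≡1 : ∀ p → M₀ Nₚ p + indeg p ≡ 1
  M₀+indeg≡1 p with indeg p in indeg≡ | indeg≤1 p
  ... | zero    | _ = trans (+-identityʳ _) (init-1 P p (λ u → sumMap≡0⇒≡0 _ events indeg≡ (∈-events u)))
  ... | suc zero | _ = cong (_+ 1) (init-0 P p (λ no-producer → 1+n≢0 (trans (sym indeg≡)
                                                   (sumMap-zero _ events (λ {u} _ → no-producer u)))))
  ... | suc (suc _) | s≤s ()

  initialOver : S N → List (S Nₚ)
  initialOver s = support (π-M₀ P s)

  producedOver : S N → T Nₚ → List (S Nₚ)
  producedOver s u = support (π-post P u s)

  placesOver : S N → List (S Nₚ)
  placesOver s = initialOver s ++ concatMap (producedOver s) events

  placesOver-sound : ∀ {s p} → p ∈ placesOver s → πS P p ≡ s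
  placesOver-sound {s} p∈ with ∈-++⁻ (initialOver s) p∈
  ... | inj₁ p∈initial  = proj₁ (support-sound (π-M₀ P s) p∈initial)
  ... | inj₂ p∈produced with ∈-concatMap⁻′ (producedOver s) events p∈produced
  ... | u , _ , p∈ = proj₁ (support-sound (π-post P u s) p∈)

  placesOver-complete : ∀ {s p} → πS P p ≡ s → p ∈ placesOver s
  placesOver-complete {s} {p} refl with 0 <? M₀ Nₚ p
  ... | yes M₀p>0 = ∈-++⁺ˡ (support-complete (π-M₀ P s) refl M₀p>0)
  ... | no M₀p≯0 with sumMap>0⇒positive (λ u → Fts Nₚ u p) events indeg>0
    where
    indeg>0 : 0 < indeg p
    indeg>0 = ≤-reflexive (sym (subst (λ m → m + indeg p ≡ 1) (n≤0⇒n≡0 (≮⇒≥ M₀p≯0)) (M₀+indeg≡1 p)))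
  ... | u , u∈ , produced =
    ∈-++⁺ʳ (initialOver s) (∈-concatMap⁺′ (producedOver s) (support-complete (π-post P u s) refl produced) u∈)

  placesOver-unique : ∀ s → Unique (placesOver s)
  placesOver-unique s = ++⁺ (support-unique (π-M₀ P s)) produced-unique initial-not-produced
    where
    produced-unique : Unique (concatMap (producedOver s) events)
    produced-unique = concatMap-unique (producedOver s) events-unique (λ u → support-unique (π-post P u s))
      (λ {u} {u′} p∈u p∈u′ → producer-unique (proj₂ (support-sound (π-post P u s) p∈u))
                                             (proj₂ (support-sound (π-post P u′ s) p∈u′)))
    initial-not-produced : ∀ {p} → ¬ (p ∈ initialOver s × p ∈ concatMap (producedOver s) events)
    initial-not-produced {p} (p∈initial , p∈produced) with ∈-concatMap⁻′ (producedOver s) events p∈produced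
    ... | u , _ , p∈ = 1+n≰n (begin
      2                  ≤⟨ +-mono-≤ initial (≤-trans produced (≤-sumMap _ (∈-events u))) ⟩
      M₀ Nₚ p + indeg p  ≡⟨ M₀+indeg≡1 p ⟩
      1                  ∎)
      where
      open ≤-Reasoning
      initial : 0 < M₀ Nₚ p
      initial = proj₂ (support-sound (π-M₀ P s) p∈initial)
      produced : 0 < Fts Nₚ u p
      produced = proj₂ (support-sound (π-post P u s) p∈)

  sumMap-placesOver : ∀ {s} {f : S Nₚ → ℕ} {n} → SumOver (λ p → πS P p ≡ s) f n → sumMap f (placesOver s) ≡ n
  sumMap-placesOver {s} fibre = SumOver⇒sumMap≡ fibre (placesOver-unique s) placesOver-sound placesOver-complete

  cut : S N → List (S Nₚ)
  cut s = filter (λ p → outdeg p ≟ 0) (placesOver s)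

  cut-unique : ∀ s → Unique (cut s)
  cut-unique s = filter⁺ (λ p → outdeg p ≟ 0) (placesOver-unique s)

  ∈-cut : ∀ {s p} → πS P p ≡ s → outdeg p ≡ 0 → p ∈ cut s
  ∈-cut πp≡s outdeg≡0 = ∈-filter⁺ (λ p → outdeg p ≟ 0) (placesOver-complete πp≡s) outdeg≡0

  cut-sound : ∀ {s p} → p ∈ cut s → πS P p ≡ s × outdeg p ≡ 0
  cut-sound p∈ with ∈-filter⁻ (λ p → outdeg p ≟ 0) p∈
  ... | p∈places , outdeg≡0 = placesOver-sound p∈places , outdeg≡0

  length-cut : ∀ {Mσ} → FiresTo N (M₀ N) σ Mσ → ∀ s → length (cut s) ≡ Mσ s
  length-cut {Mσ} σ-fires s = +-cancelʳ-≡ _ _ _ (begin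
    length (cut s) + sumMap (Fst N s) σ               ≡⟨ cong₂ _+_ (length-filter-≟0 outdeg L) (sym outdeg-total) ⟩
    sumMap (λ p → 1 ∸ outdeg p) L + sumMap outdeg L   ≡⟨ sumMap-+ (λ p → 1 ∸ outdeg p) outdeg L ⟨
    sumMap (λ p → 1 ∸ outdeg p + outdeg p) L          ≡⟨ sumMap-cong L (λ {p} _ → trans (m∸n+n≡m (outdeg≤1 p)) (sym (M₀+indeg≡1 p))) ⟩
    sumMap (λ p → M₀ Nₚ p + indeg p) L                ≡⟨ sumMap-+ (M₀ Nₚ) indeg L ⟩
    sumMap (M₀ Nₚ) L + sumMap indeg L                 ≡⟨ cong₂ _+_ (sumMap-placesOver (π-M₀ P s)) indeg-total ⟩
    M₀ N s + sumMap (λ t → Fts N t s) σ               ≡⟨ marking-equation σ-fires s ⟨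
    Mσ s + sumMap (Fst N s) σ                         ∎)
    where
    open ≡-Reasoning
    L : List (S Nₚ)
    L = placesOver s
    outdeg-total : sumMap outdeg L ≡ sumMap (Fst N s) σ
    outdeg-total = trans (sumMap-swap (Fst Nₚ) L events)
      (trans (sumMap-cong events (λ {u} _ → sumMap-placesOver (π-pre P u s))) (sumMap-events-πT (Fst N s)))
    indeg-total : sumMap indeg L ≡ sumMap (λ t → Fts N t s) σ
    indeg-total = trans (sumMap-swap (λ p u → Fts Nₚ u p) L events)
      (trans (sumMap-cong events (λ {u} _ → sumMap-placesOver (π-post P u s))) (sumMap-events-πT (λ t → Fts N t s)))

module Extension {N : Net} (P : GRProcess N) (σ : List (T N)) (compatible : Compatible P σ)
                 (t : T N) {Mσ : Marking N} (σ-fires : FiresTo N (M₀ N) σ Mσ) (enabled : ∀ s → Fst N s t ≤ Mσ s) where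

  open CompatibleProcess P σ compatible

  chosen : S N → List (S Nₚ)
  chosen s = take (Fst N s t) (cut s)

  chosen-unique : ∀ s → Unique (chosen s)
  chosen-unique s = take⁺ (Fst N s t) (cut-unique s)

  length-chosen : ∀ s → length (chosen s) ≡ Fst N s t
  length-chosen s =
    trans (length-take _ (cut s)) (m≤n⇒m⊓n≡m (subst (Fst N s t ≤_) (sym (length-cut σ-fires s)) (enabled s)))

  chosen-sound : ∀ {s p} → p ∈ chosen s → πS P p ≡ s × outdeg p ≡ 0
  chosen-sound {s} p∈ = cut-sound (proj₁ (∈-take⁻ (Fst N s t) p∈))

  chosen? : ∀ p → Dec (p ∈ chosen (πS P p))
  chosen? p with outdeg p ≟ 0
  ... | yes outdeg≡0 = ∈-take? (Fst N (πS P p) t) (cut-unique _) (∈-cut refl outdeg≡0)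
  ... | no outdeg≢0  = no (outdeg≢0 ∘ proj₂ ∘ chosen-sound)

  consumption : S Nₚ → ℕ
  consumption p with chosen? p
  ... | yes _ = 1
  ... | no _  = 0

  consumption-chosen : ∀ {s p} → p ∈ chosen s → consumption p ≡ 1
  consumption-chosen {p = p} p∈ with chosen? p
  ... | yes _ = refl
  ... | no p∉  = ⊥-elim (p∉ (subst (λ s → p ∈ chosen s) (sym (proj₁ (chosen-sound p∈))) p∈))

  consumption>0⇒chosen : ∀ {p} → 0 < consumption p → p ∈ chosen (πS P p)
  consumption>0⇒chosen {p} consumed with chosen? p
  ... | yes p∈ = p∈

  outdeg+consumption≤1 : ∀ p → outdeg p + consumption p ≤ 1
  outdeg+consumption≤1 p with chosen? p
  ... | yes p∈ = ≤-reflexive (cong (_+ 1) (proj₂ (chosen-sound p∈)))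
  ... | no _   = subst (_≤ 1) (sym (+-identityʳ (outdeg p))) (outdeg≤1 p)

  NewPlace : Set
  NewPlace = Σ (S N) λ s → Fin (Fts N t s)

  S′ : Set
  S′ = S Nₚ ⊎ NewPlace

  T′ : Set
  T′ = T Nₚ ⊎ ⊤

  Fst′ : S′ → T′ → ℕ
  Fst′ (inj₁ p) (inj₁ u) = Fst Nₚ p u
  Fst′ (inj₁ p) (inj₂ _) = consumption p
  Fst′ (inj₂ _) _        = 0

  Fts′ : T′ → S′ → ℕ
  Fts′ (inj₁ u) (inj₁ p) = Fts Nₚ u p
  Fts′ (inj₁ _) (inj₂ _) = 0
  Fts′ (inj₂ _) (inj₁ _) = 0
  Fts′ (inj₂ _) (inj₂ _) = 1

  M₀′ : S′ → ℕ
  M₀′ (inj₁ p) = M₀ Nₚ p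
  M₀′ (inj₂ _) = 0

  newPlacesOver : S N → List S′
  newPlacesOver s = map (λ i → inj₂ (s , i)) (allFin (Fts N t s))

  ∈-newPlacesOver : ∀ {s} (i : Fin (Fts N t s)) → inj₂ (s , i) ∈ newPlacesOver s
  ∈-newPlacesOver i = ∈-map⁺ _ (∈-allFin i)

  preset′ : T′ → List S′
  preset′ (inj₁ u) = map inj₁ (proj₁ (pre-finite Nₚ u))
  preset′ (inj₂ _) = map inj₁ (concatMap chosen (proj₁ (pre-finite N t)))

  ∈-preset′ : ∀ u a → 0 < Fst′ a u → a ∈ preset′ u
  ∈-preset′ (inj₁ u) (inj₁ p) Fpu>0 = ∈-map⁺ inj₁ (proj₂ (pre-finite Nₚ u) p Fpu>0)
  ∈-preset′ (inj₂ _) (inj₁ p) consumed = ∈-map⁺ inj₁ (∈-concatMap⁺′ chosen p∈ (proj₂ (pre-finite N t) (πS P p) Fst>0))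
    where
    p∈ : p ∈ chosen (πS P p)
    p∈ = consumption>0⇒chosen consumed
    Fst>0 : 0 < Fst N (πS P p) t
    Fst>0 = subst (0 <_) (length-chosen (πS P p)) (∈-length p∈)

  postset′ : T′ → List S′
  postset′ (inj₁ u) = map inj₁ (proj₁ (post-finite Nₚ u))
  postset′ (inj₂ _) = concatMap newPlacesOver (proj₁ (post-finite N t))

  ∈-postset′ : ∀ u a → 0 < Fts′ u a → a ∈ postset′ u
  ∈-postset′ (inj₁ u) (inj₁ p)       Fup>0 = ∈-map⁺ inj₁ (proj₂ (post-finite Nₚ u) p Fup>0)
  ∈-postset′ (inj₂ _) (inj₂ (s , i)) _     =
    ∈-concatMap⁺′ newPlacesOver (∈-newPlacesOver i) (proj₂ (post-finite N t) s (≤-<-trans z≤n (toℕ<n i)))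

  preset′-nonempty : ∀ u → ∃ λ a → 0 < Fst′ a u
  preset′-nonempty (inj₁ u) = let p , Fpu>0 = pre-nonempty Nₚ u in inj₁ p , Fpu>0
  preset′-nonempty (inj₂ _) with pre-nonempty N t
  ... | s , Fst>0 with nonempty-member (chosen s) (subst (0 <_) (sym (length-chosen s)) Fst>0)
  ... | p , p∈ = inj₁ p , ≤-reflexive (sym (consumption-chosen p∈))

  N′ : Net
  N′ = record
    { S = S′ ; T = T′ ; Fst = Fst′ ; Fts = Fts′ ; M₀ = M₀′
    ; pre-finite = λ u → preset′ u , ∈-preset′ u
    ; post-finite = λ u → postset′ u , ∈-postset′ u
    ; pre-nonempty = preset′-nonempty }

  πS′ : S′ → S N
  πS′ (inj₁ p)       = πS P p
  πS′ (inj₂ (s , _)) = s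

  πT′ : T′ → T N
  πT′ (inj₁ u) = πT P u
  πT′ (inj₂ _) = t

  transitions′ : List T′
  transitions′ = map inj₁ events ++ inj₂ tt ∷ []

  transitions′-unique : Unique transitions′
  transitions′-unique = ++⁺ (map⁺ inj₁-injective events-unique) (All.[] ∷ []) old≢new
    where
    old≢new : ∀ {u} → ¬ (u ∈ map inj₁ events × u ∈ inj₂ tt ∷ [])
    old≢new (u∈ , here refl) with ∈-map⁻ inj₁ u∈
    ... | _ , _ , ()

  ∈-transitions′ : ∀ u → u ∈ transitions′
  ∈-transitions′ (inj₁ u) = ∈-++⁺ˡ (∈-map⁺ inj₁ (∈-events u))
  ∈-transitions′ (inj₂ tt) = ∈-++⁺ʳ (map inj₁ events) (here refl)

  sum≤1⇒AtMostOne′ : (f : T′ → ℕ) → sumMap (f ∘ inj₁) events + f (inj₂ tt) ≤ 1 → AtMostOne f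
  sum≤1⇒AtMostOne′ f total≤1 =
    _ , (transitions′ , transitions′-unique , All.tabulate (λ _ → tt) , (λ u _ _ → ∈-transitions′ u) , total) , total≤1
    where
    total : sumMap f transitions′ ≡ sumMap (f ∘ inj₁) events + f (inj₂ tt)
    total = trans (sumMap-++ f (map inj₁ events) (inj₂ tt ∷ []))
                  (cong₂ _+_ (sumMap-map f inj₁ events) (+-identityʳ (f (inj₂ tt))))

  producers′-≤1 : ∀ a → AtMostOne (λ u → Fts′ u a)
  producers′-≤1 (inj₁ p) = sum≤1⇒AtMostOne′ _ (subst (_≤ 1) (sym (+-identityʳ (indeg p))) (indeg≤1 p))
  producers′-≤1 (inj₂ _) = sum≤1⇒AtMostOne′ _ (≤-reflexive (cong (_+ 1) (sumMap-zero _ events (λ _ → refl))))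

  consumers′-≤1 : ∀ a → AtMostOne (λ u → Fst′ a u)
  consumers′-≤1 (inj₁ p) = sum≤1⇒AtMostOne′ _ (outdeg+consumption≤1 p)
  consumers′-≤1 (inj₂ _) = sum≤1⇒AtMostOne′ _ (≤-trans (≤-reflexive (cong (_+ 0) (sumMap-zero _ events (λ _ → refl)))) z≤n)

  initial′ : ∀ a → (∀ u → Fts′ u a ≡ 0) → M₀′ a ≡ 1
  initial′ (inj₁ p) unproduced = init-1 P p (unproduced ∘ inj₁)
  initial′ (inj₂ _) unproduced = ⊥-elim (1+n≢0 (unproduced (inj₂ tt)))

  non-initial′ : ∀ a → ¬ (∀ u → Fts′ u a ≡ 0) → M₀′ a ≡ 0
  non-initial′ (inj₁ p) produced = init-0 P p (λ unproduced → produced λ { (inj₁ u) → unproduced u ; (inj₂ _) → refl })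
  non-initial′ (inj₂ _) _        = refl

  old : S Nₚ ⊎ T Nₚ → S′ ⊎ T′
  old (inj₁ p) = inj₁ (inj₁ p)
  old (inj₂ u) = inj₂ (inj₁ u)

  old-injective : ∀ {x y} → old x ≡ old y → x ≡ y
  old-injective {inj₁ _} {inj₁ _} refl = refl
  old-injective {inj₂ _} {inj₂ _} refl = refl

  arc-into-old : ∀ x y → Arc N′ x (old y) → ∃ λ x₀ → x ≡ old x₀ × Arc Nₚ x₀ y
  arc-into-old (inj₁ (inj₁ p)) (inj₂ u) arc = inj₁ p , refl , arc
  arc-into-old (inj₂ (inj₁ u)) (inj₁ p) arc = inj₂ u , refl , arc

  flow-into-old : ∀ {x y} → Flow⁺ N′ x y → ∀ y₀ → y ≡ old y₀ → ∃ λ x₀ → x ≡ old x₀ × Flow⁺ Nₚ x₀ y₀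
  flow-into-old {x} [ arc ] y₀ refl with arc-into-old x y₀ arc
  ... | x₀ , refl , arc₀ = x₀ , refl , [ arc₀ ]
  flow-into-old {x} (arc ∷ path) y₀ y≡ with flow-into-old path y₀ y≡
  ... | z₀ , refl , path₀ with arc-into-old x z₀ arc
  ... | x₀ , refl , arc₀ = x₀ , refl , arc₀ ∷ path₀

  new-place-is-sink : ∀ {q y} → ¬ Flow⁺ N′ (inj₁ (inj₂ q)) y
  new-place-is-sink {y = inj₁ _}        [ () ]
  new-place-is-sink {y = inj₂ (inj₁ _)} [ () ]
  new-place-is-sink {y = inj₂ (inj₂ _)} [ () ]
  new-place-is-sink (_∷_ {y = inj₁ _}        () _)
  new-place-is-sink (_∷_ {y = inj₂ (inj₁ _)} () _)
  new-place-is-sink (_∷_ {y = inj₂ (inj₂ _)} () _)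

  old-acyclic : ∀ x₀ → ¬ Flow⁺ N′ (old x₀) (old x₀)
  old-acyclic x₀ cycle with flow-into-old cycle x₀ refl
  ... | x₁ , x₀≡x₁ , cycle₀ rewrite old-injective x₀≡x₁ = irrefl P x₁ cycle₀

  acyclic′ : ∀ x → ¬ Flow⁺ N′ x x
  acyclic′ (inj₁ (inj₁ p)) = old-acyclic (inj₁ p)
  acyclic′ (inj₂ (inj₁ u)) = old-acyclic (inj₂ u)
  acyclic′ (inj₁ (inj₂ _)) = new-place-is-sink
  acyclic′ (inj₂ (inj₂ _)) [ () ]
  acyclic′ (inj₂ (inj₂ _)) (_∷_ {y = inj₁ (inj₁ _)} () _)
  acyclic′ (inj₂ (inj₂ _)) (_∷_ {y = inj₁ (inj₂ _)} _ path) = new-place-is-sink path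
  acyclic′ (inj₂ (inj₂ _)) (_∷_ {y = inj₂ _} () _)

  π-pre′ : ∀ u s → SumOver (λ a → πS′ a ≡ s) (λ a → Fst′ a u) (Fst N s (πT′ u))
  π-pre′ (inj₁ u) s = SumOver-inj₁ (λ _ → refl) (π-pre P u s)
  π-pre′ (inj₂ _) s =
    map inj₁ (chosen s) , map⁺ inj₁-injective (chosen-unique s) , All.map⁺ (All.tabulate (proj₁ ∘ chosen-sound)) ,
    consumed⇒∈ , total
    where
    consumed⇒∈ : ∀ a → πS′ a ≡ s → 0 < Fst′ a (inj₂ tt) → a ∈ map inj₁ (chosen s)
    consumed⇒∈ (inj₁ p) refl consumed = ∈-map⁺ inj₁ (consumption>0⇒chosen consumed)
    total : sumMap (λ a → Fst′ a (inj₂ tt)) (map inj₁ (chosen s)) ≡ Fst N s t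
    total = begin
      sumMap (λ a → Fst′ a (inj₂ tt)) (map inj₁ (chosen s)) ≡⟨ sumMap-map _ inj₁ (chosen s) ⟩
      sumMap consumption (chosen s)                         ≡⟨ sumMap-cong (chosen s) consumption-chosen ⟩
      sumMap (λ _ → 1) (chosen s)                           ≡⟨ sumMap-const-1 (chosen s) ⟩
      length (chosen s)                                     ≡⟨ length-chosen s ⟩
      Fst N s t                                             ∎
      where open ≡-Reasoning

  π-post′ : ∀ u s → SumOver (λ a → πS′ a ≡ s) (λ a → Fts′ u a) (Fts N (πT′ u) s)
  π-post′ (inj₁ u) s = SumOver-inj₁ (λ _ → refl) (π-post P u s)
  π-post′ (inj₂ _) s =
    newPlacesOver s , map⁺ (λ { refl → refl }) (allFin⁺ _) , All.map⁺ (All.tabulate (λ _ → refl)) , produced⇒∈ , total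
    where
    produced⇒∈ : ∀ a → πS′ a ≡ s → 0 < Fts′ (inj₂ tt) a → a ∈ newPlacesOver s
    produced⇒∈ (inj₂ (s , i)) refl _ = ∈-newPlacesOver i
    total : sumMap (Fts′ (inj₂ tt)) (newPlacesOver s) ≡ Fts N t s
    total = trans (sumMap-map (Fts′ (inj₂ tt)) (λ i → inj₂ (s , i)) (allFin (Fts N t s)))
                  (trans (sumMap-const-1 (allFin (Fts N t s))) (length-tabulate (λ i → i)))

  P′ : GRProcess N
  P′ = record
    { 𝒩 = N′ ; pre-≤1 = producers′-≤1 ; post-≤1 = consumers′-≤1 ; init-1 = initial′ ; init-0 = non-initial′
    ; irrefl = acyclic′ ; fin-past = λ _ → transitions′ , (λ u _ → ∈-transitions′ u)
    ; πS = πS′ ; πT = πT′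
    ; π-M₀ = λ s → SumOver-inj₁ (λ _ → refl) (π-M₀ P s)
    ; π-pre = π-pre′ ; π-post = π-post′ }

  P≤P′ : P ≤ₚ P′
  P≤P′ = record
    { ιS = inj₁ ; ιT = inj₁ ; ιS-inj = inj₁-injective ; ιT-inj = inj₁-injective
    ; M₀-restr = λ _ → refl
    ; M₀-cover = λ { (inj₁ p) _ → p , refl ; (inj₂ _) () }
    ; Fst-restr = λ _ _ → refl ; Fts-restr = λ _ _ → refl
    ; πS-restr = λ _ → refl ; πT-restr = λ _ → refl }

  σ′ : List (T N)
  σ′ = σ ++ t ∷ []

  rank : T′ → ℕ
  rank (inj₁ u) = toℕ (pos u)
  rank (inj₂ _) = length σ

  rank<length : ∀ u → rank u < length σ′
  rank<length u = subst (rank u <_) (sym (length-∷ʳ σ t)) (s≤s (rank≤ u))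
    where
    rank≤ : ∀ u → rank u ≤ length σ
    rank≤ (inj₁ u) = <⇒≤ (toℕ<n (pos u))
    rank≤ (inj₂ _) = ≤-refl

  pos′ : T′ → Fin (length σ′)
  pos′ u = fromℕ< (rank<length u)

  toℕ-pos′ : ∀ u → toℕ (pos′ u) ≡ rank u
  toℕ-pos′ u = toℕ-fromℕ< (rank<length u)

  rank-injective : ∀ {u v} → rank u ≡ rank v → u ≡ v
  rank-injective {inj₁ u} {inj₁ v}   eq = cong inj₁ (pos-injective (toℕ-injective eq))
  rank-injective {inj₁ u} {inj₂ _}   eq = ⊥-elim (<-irrefl eq (toℕ<n (pos u)))
  rank-injective {inj₂ _} {inj₁ v}   eq = ⊥-elim (<-irrefl (sym eq) (toℕ<n (pos v)))
  rank-injective {inj₂ tt} {inj₂ tt} _  = refl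

  pos′-injective : ∀ {u v} → pos′ u ≡ pos′ v → u ≡ v
  pos′-injective {u} {v} eq = rank-injective (trans (sym (toℕ-pos′ u)) (trans (cong toℕ eq) (toℕ-pos′ v)))

  pos′-surjective : ∀ j → ∃ λ u → ∀ {v} → v ≡ u → pos′ v ≡ j
  pos′-surjective j with m<1+n⇒m<n∨m≡n (subst (toℕ j <_) (length-∷ʳ σ t) (toℕ<n j))
  ... | inj₁ j<n = inj₁ (pos⁻¹ (fromℕ< j<n)) ,
                   λ { refl → toℕ-injective (trans (toℕ-pos′ (inj₁ _)) (trans (cong toℕ (pos∘pos⁻¹ _)) (toℕ-fromℕ< j<n))) }
  ... | inj₂ j≡n = inj₂ tt , λ { refl → toℕ-injective (trans (toℕ-pos′ (inj₂ tt)) (sym j≡n)) }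

  πT′≡lookup : ∀ u → πT′ u ≡ lookup σ′ (pos′ u)
  πT′≡lookup (inj₁ u) = trans (πT≡lookup u) (sym (lookup-++ˡ σ (t ∷ []) (pos′ (inj₁ u)) (pos u) (toℕ-pos′ (inj₁ u))))
  πT′≡lookup (inj₂ _) = sym (lookup-∷ʳ-last σ t (pos′ (inj₂ tt)) (toℕ-pos′ (inj₂ tt)))

  rank-monotone : ∀ u v → Flow⁺ N′ (inj₂ u) (inj₂ v) → rank u < rank v
  rank-monotone u (inj₁ v) path with flow-into-old path (inj₂ v) refl
  ... | inj₂ u₀ , refl , path₀ = pos-monotone u₀ v path₀
  rank-monotone (inj₁ u) (inj₂ _) _ = toℕ<n (pos u)
  rank-monotone (inj₂ tt) (inj₂ tt) cycle = ⊥-elim (acyclic′ _ cycle)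

  compatible′ : Compatible P′ σ′
  compatible′ = pos′ , (pos′-injective , pos′-surjective) , πT′≡lookup ,
                λ u v path → subst₂ _<_ (sym (toℕ-pos′ u)) (sym (toℕ-pos′ v)) (rank-monotone u v path)


Compatible⇒FiniteProcess : {N : Net} (P : GRProcess N) (σ : List (T N)) → Compatible P σ → FiniteProcess P
Compatible⇒FiniteProcess P σ compatible = events , ∈-events
  where open CompatibleProcess P σ compatible

Lin-extend-∷ʳ : {N : Net} (P : GRProcess N) (σ : List (T N)) → Lin P σ → (t : T N) (τ : List (T N)) →
                FS N (σ ++ t ∷ τ) → Σ (GRProcess N) λ P′ → Lin P′ (σ ++ t ∷ []) × (P ≤ₚ P′)
Lin-extend-∷ʳ {N} P σ (_ , compatible) t τ στ-fires with fires-++⁻ σ στ-fires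
... | _ , σ-fires , fire-∷ (enabled , _) _ = P′ , (σt-fires , compatible′) , P≤P′
  where
  open Extension P σ compatible t σ-fires enabled
  σt-fires : FS N (σ ++ t ∷ [])
  σt-fires = fires-prefix (σ ++ t ∷ []) (subst (FS N) (sym (++-assoc σ (t ∷ []) τ)) στ-fires)

Lin-extend : {N : Net} (τ : List (T N)) (P : GRProcess N) (σ : List (T N)) → Lin P σ → FS N (σ ++ τ) →
             Σ (GRProcess N) λ P′ → FiniteProcess P′ × Lin P′ (σ ++ τ) × (P ≤ₚ P′)
Lin-extend [] P σ σ∈Lin _ rewrite ++-identityʳ σ = P , Compatible⇒FiniteProcess P σ (proj₂ σ∈Lin) , σ∈Lin , ≤ₚ-refl
Lin-extend {N} (t ∷ τ) P σ σ∈Lin στ-fires with Lin-extend-∷ʳ P σ σ∈Lin t τ στ-fires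
... | P₁ , σt∈Lin , P≤P₁ with Lin-extend τ P₁ (σ ++ t ∷ []) σt∈Lin (subst (FS N) (sym (++-assoc σ (t ∷ []) τ)) στ-fires)
... | P₂ , P₂-finite , στ∈Lin , P₁≤P₂ = P₂ , P₂-finite , subst (Lin P₂) (++-assoc σ (t ∷ []) τ) στ∈Lin , ≤ₚ-trans P≤P₁ P₁≤P₂

lemma3 : (N : Net) (P'' : GRProcess N) → FiniteProcess P'' →
         (σ'' σ' : List (T N)) → Lin P'' σ'' → FS N σ' → σ'' ≼ σ' →
         Σ (GRProcess N) λ P' → FiniteProcess P' × Lin P' σ' × (P'' ≤ₚ P')
lemma3 N P'' _ σ'' .(σ'' ++ τ) σ''∈Lin σ'-fires (τ , refl) = Lin-extend τ P'' σ'' σ''∈Lin σ'-fires
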